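{- There is an absolute constant $C>0$ such that the following holds. Let $\mathbb{F}_q$ be any finite field and let $E\subset\mathbb{F}_q^2$. Let $R_E=\{\theta\in\mathrm{SL}_2(\mathbb{F}_q) : \theta(E)=E\}$. Suppose that at least $2$ distinct lines through the origin intersect $E\setminus\{(0,0)\}$. Then $|R_E|\leq C|E|^{3/2}$.
   Context: $\mathrm{SL}_2(\mathbb{F}_q)$ acts on $\mathbb{F}_q^2$ by matrix multiplication on column vectors; $\theta(E)=\{\theta x: x\in E\}$. The constant $C$ does not depend on $q$ or $E$. -}

module Defs where

open import Level using (0ℓ)
open import Data.Nat using (ℕ)
open import Data.Fin using (Fin)
open import Data.Product using (Σ; ∃; _×_; _,_)
open import Data.List using (List)
open import Data.List.Membership.Propositional using (_∈_)
open import Relation.Binary.PropositionalEquality using (_≡_; _≢_)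
open import Relation.Nullary using (¬_)
open import Algebra.Structures using (IsCommutativeRing)
open import Function.Bundles using (_↔_)

record FiniteField : Set₁ where
  field
    Carrier : Set
    _+_ _*_ : Carrier → Carrier → Carrier
    -_      : Carrier → Carrier
    0# 1#   : Carrier
    isCommutativeRing : IsCommutativeRing _≡_ _+_ _*_ -_ 0# 1#
    0≢1     : 0# ≢ 1#
    inverse : ∀ x → x ≢ 0# → ∃ λ y → x * y ≡ 1#
    q       : ℕ
    enum    : Fin q ↔ Carrier

  infixl 7 _*_
  infixl 6 _+_ _-_

  _-_ : Carrier → Carrier → Carrier
  x - y = x + (- y)

  Point : Set
  Point = Carrier × Carrier

  origin : Point
  origin = 0# , 0#

  record Mat : Set where
    eta-equality
    constructor mat
    field a b c d : Carrier

  det : Mat → Carrier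
  det (mat a b c d) = a * d - b * c

  InSL2 : Mat → Set
  InSL2 M = det M ≡ 1#

  act : Mat → Point → Point
  act (mat a b c d) (x , y) = (a * x + b * y , c * x + d * y)

  Preserves : Mat → List Point → Set
  Preserves θ E = (∀ x → x ∈ E → act θ x ∈ E)
                × (∀ y → y ∈ E → ∃ λ x → x ∈ E × act θ x ≡ y)

  OnLine : Point → Point → Set
  OnLine (w₁ , w₂) p = ∃ λ t → p ≡ (t * w₁ , t * w₂)

  TwoLines : List Point → Set
  TwoLines E = ∃ λ u → ∃ λ v → u ∈ E × v ∈ E × u ≢ origin × v ≢ origin
               × ¬ OnLine u v

{-# OPTIONS --safe #-}
module Submission where

-- Choose u, v ∈ E on different lines through the origin, so that D = det(u, v) ≠ 0.  A matrix θ
-- is determined by the pair (θu, θv) ∈ E × E, and for det θ = 1 that pair lies on the curve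
-- det(x, y) = D.  For x ≠ x′ the lines {y : det(x, y) = D} and {y : det(x′, y) = D} share at most
-- one point, so these pairs form a set S ⊆ E × E containing no rectangle {x, x′} × {y, y′}.
-- Counting the pairs of elements of S with equal first coordinate, Cauchy–Schwarz gives
-- |S|² ≤ |E| (|S| + |E|²) ≤ 2 |E|³, the Kővári–Sós–Turán bound for K₂,₂-free bipartite graphs.

open import Defs
open import Algebra.Bundles using (CommutativeRing)

-- The ring solver of Algebra.Solver.Ring with integer coefficients, mapped into R by the
-- canonical homomorphism ι; unlike the natural-number instance it handles subtraction.
module IntegerRingSolver {c ℓ} (R : CommutativeRing c ℓ) where

  open import Algebra.Solver.Ring.AlmostCommutativeRing
    using (_-Raw-AlmostCommutative⟶_; fromCommutativeRing; Induced-equivalence)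
  open import Data.Integer.Base as ℤ using (ℤ; +_; -[1+_]; _⊖_)
  import Data.Integer.Properties as ℤ
  import Data.Maybe.Base as Maybe
  open import Data.Nat.Base as ℕ using (zero; suc)
  import Data.Nat.Properties as ℕ
  open import Relation.Binary.Consequences using (dec⇒weaklyDec)
  open import Relation.Binary.Definitions using (WeaklyDecidable)
  import Relation.Binary.PropositionalEquality.Core as ≡

  open CommutativeRing R
  open import Algebra.Properties.Ring ring
    using (-0#≈0#; -‿involutive; -‿+-comm; -‿distribˡ-*; -‿distribʳ-*)
  open import Algebra.Properties.CommutativeSemigroup +-commutativeSemigroup using (interchange)
  open import Algebra.Properties.Semiring.Mult semiring using (_×_; ×-homo-+; ×1-homo-*)
  open import Relation.Binary.Reasoning.Setoid setoid

  ι : ℤ → Carrier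
  ι (+ n)    = n × 1#
  ι -[1+ n ] = - (suc n × 1#)

  ι-⊖ : ∀ m n → ι (m ⊖ n) ≈ m × 1# - n × 1#
  ι-⊖ m       zero    = sym (trans (+-congˡ -0#≈0#) (+-identityʳ _))
  ι-⊖ zero    (suc n) = sym (+-identityˡ _)
  ι-⊖ (suc m) (suc n) = begin
    ι (suc m ⊖ suc n)          ≡⟨ ≡.cong ι (ℤ.[1+m]⊖[1+n]≡m⊖n m n) ⟩
    ι (m ⊖ n)                  ≈⟨ ι-⊖ m n ⟩
    a - b                      ≈⟨ +-identityˡ (a - b) ⟨
    0# + (a - b)               ≈⟨ +-congʳ (-‿inverseʳ 1#) ⟨
    (1# - 1#) + (a - b)        ≈⟨ interchange 1# a (- 1#) (- b) ⟨
    (1# + a) + (- 1# + - b)    ≈⟨ +-congˡ (-‿+-comm 1# b) ⟩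
    (1# + a) - (1# + b)        ∎
    where a = m × 1#; b = n × 1#

  ι-+ : ∀ i j → ι (i ℤ.+ j) ≈ ι i + ι j
  ι-+ (+ m)      (+ n)      = ×-homo-+ 1# m n
  ι-+ (+ m)      -[1+ n ]   = ι-⊖ m (suc n)
  ι-+ -[1+ m ]   (+ n)      = trans (ι-⊖ n (suc m)) (+-comm _ _)
  ι-+ -[1+ m ]   -[1+ n ]   = begin
    - (suc (suc (m ℕ.+ n)) × 1#)      ≡⟨ ≡.cong (λ k → - (suc k × 1#)) (ℕ.+-suc m n) ⟨
    - ((suc m ℕ.+ suc n) × 1#)        ≈⟨ -‿cong (×-homo-+ 1# (suc m) (suc n)) ⟩
    - (suc m × 1# + suc n × 1#)       ≈⟨ -‿+-comm _ _ ⟨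
    - (suc m × 1#) + - (suc n × 1#)   ∎

  ι-neg : ∀ i → ι (ℤ.- i) ≈ - ι i
  ι-neg (+ zero)  = sym -0#≈0#
  ι-neg (+ suc n) = refl
  ι-neg -[1+ n ]  = sym (-‿involutive _)

  ι-*-pos : ∀ m n → ι (+ m ℤ.* + n) ≈ ι (+ m) * ι (+ n)
  ι-*-pos m n = trans (reflexive (≡.cong ι (≡.sym (ℤ.pos-* m n)))) (×1-homo-* m n)

  ι-* : ∀ i j → ι (i ℤ.* j) ≈ ι i * ι j
  ι-* (+ m)    (+ n)    = ι-*-pos m n
  ι-* (+ m)    -[1+ n ] = begin
    ι (+ m ℤ.* ℤ.- + suc n)           ≡⟨ ≡.cong ι (ℤ.neg-distribʳ-* (+ m) (+ suc n)) ⟨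
    ι (ℤ.- (+ m ℤ.* + suc n))         ≈⟨ ι-neg (+ m ℤ.* + suc n) ⟩
    - ι (+ m ℤ.* + suc n)             ≈⟨ -‿cong (ι-*-pos m (suc n)) ⟩
    - (ι (+ m) * ι (+ suc n))         ≈⟨ -‿distribʳ-* _ _ ⟩
    ι (+ m) * - ι (+ suc n)           ∎
  ι-* -[1+ m ] (+ n)    = begin
    ι (ℤ.- + suc m ℤ.* + n)           ≡⟨ ≡.cong ι (ℤ.neg-distribˡ-* (+ suc m) (+ n)) ⟨
    ι (ℤ.- (+ suc m ℤ.* + n))         ≈⟨ ι-neg (+ suc m ℤ.* + n) ⟩
    - ι (+ suc m ℤ.* + n)             ≈⟨ -‿cong (ι-*-pos (suc m) n) ⟩
    - (ι (+ suc m) * ι (+ n))         ≈⟨ -‿distribˡ-* _ _ ⟩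
    - ι (+ suc m) * ι (+ n)           ∎
  ι-* -[1+ m ] -[1+ n ] = begin
    ι (ℤ.- + suc m ℤ.* ℤ.- + suc n)   ≡⟨ ≡.cong ι (ℤ.neg-distribˡ-* (+ suc m) (ℤ.- + suc n)) ⟨
    ι (ℤ.- (+ suc m ℤ.* ℤ.- + suc n)) ≡⟨ ≡.cong (λ k → ι (ℤ.- k)) (ℤ.neg-distribʳ-* (+ suc m) (+ suc n)) ⟨
    ι (ℤ.- ℤ.- (+ suc m ℤ.* + suc n)) ≡⟨ ≡.cong ι (ℤ.neg-involutive (+ suc m ℤ.* + suc n)) ⟩
    ι (+ suc m ℤ.* + suc n)           ≈⟨ ι-*-pos (suc m) (suc n) ⟩
    a * b                             ≈⟨ -‿involutive (a * b) ⟨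
    - - (a * b)                       ≈⟨ -‿cong (-‿distribʳ-* a b) ⟩
    - (a * - b)                       ≈⟨ -‿distribˡ-* a (- b) ⟩
    - a * - b                         ∎
    where a = suc m × 1#; b = suc n × 1#

  homomorphism : ℤ.+-*-rawRing -Raw-AlmostCommutative⟶ fromCommutativeRing R
  homomorphism = record
    { ⟦_⟧    = ι
    ; +-homo = ι-+
    ; *-homo = ι-*
    ; -‿homo = ι-neg
    ; 0-homo = refl
    ; 1-homo = +-identityʳ 1#
    }

  ι-≟ : WeaklyDecidable (Induced-equivalence homomorphism)
  ι-≟ i j = Maybe.map (λ { ≡.refl → refl }) (dec⇒weaklyDec ℤ._≟_ i j)

  open import Algebra.Solver.Ring ℤ.+-*-rawRing (fromCommutativeRing R) homomorphism ι-≟ public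

module Counting where

  open import Data.Nat.Base using (ℕ; suc; _+_; _*_; _≤_; z≤n; s≤s)
  open import Data.Nat.Properties
    using ( +-comm; +-assoc; +-mono-≤; +-monoʳ-≤; *-comm; *-zeroʳ; *-identityʳ; *-distribˡ-+
          ; *-monoʳ-≤; ≤-reflexive; ≤-trans; ≤-total; m≤m+n; m≤n+m; m≤n⇒∃[o]m+o≡n; module ≤-Reasoning)
  open import Data.Nat.Tactic.RingSolver using (solve-∀)
  open import Data.List.Base using (List; []; _∷_; length; map; _++_; filter; cartesianProduct)
  open import Data.List.Membership.Propositional using (_∈_)
  open import Data.List.Membership.Propositional.Properties using (∈-filter⁻)
  open import Data.List.Relation.Unary.Any using (here; there)
  open import Data.List.Relation.Unary.All using (_∷_)
  open import Data.List.Relation.Unary.AllPairs using (_∷_)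
  open import Data.List.Relation.Unary.Unique.Propositional using (Unique)
  open import Data.List.Relation.Unary.Unique.Propositional.Properties using (filter⁺)
  open import Data.Product.Base using (_×_; _,_)
  open import Data.Sum.Base using (_⊎_; inj₁; inj₂; [_,_]′)
  open import Function.Base using (_∘_)
  open import Relation.Binary.Definitions using (DecidableEquality)
  open import Relation.Binary.PropositionalEquality
  open import Relation.Nullary using (Dec; yes; no; contradiction)
  open import Relation.Unary using (Pred; Decidable)

  private variable
    A B : Set

  ∑ : List A → (A → ℕ) → ℕ
  ∑ []       f = 0
  ∑ (x ∷ xs) f = f x + ∑ xs f

  syntax ∑ xs (λ x → e) = ∑[ x ∈ xs ] e

  ∑-cong : ∀ xs {f g : A → ℕ} → (∀ {x} → x ∈ xs → f x ≡ g x) → ∑ xs f ≡ ∑ xs g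
  ∑-cong []       f≡g = refl
  ∑-cong (x ∷ xs) f≡g = cong₂ _+_ (f≡g (here refl)) (∑-cong xs (f≡g ∘ there))

  ∑-mono-≤ : ∀ xs {f g : A → ℕ} → (∀ {x} → x ∈ xs → f x ≤ g x) → ∑ xs f ≤ ∑ xs g
  ∑-mono-≤ []       f≤g = z≤n
  ∑-mono-≤ (x ∷ xs) f≤g = +-mono-≤ (f≤g (here refl)) (∑-mono-≤ xs (f≤g ∘ there))

  ∑-const : ∀ (xs : List A) c → ∑[ x ∈ xs ] c ≡ length xs * c
  ∑-const []       c = refl
  ∑-const (x ∷ xs) c = cong (c +_) (∑-const xs c)

  length≡∑1 : ∀ (xs : List A) → length xs ≡ ∑[ x ∈ xs ] 1
  length≡∑1 []       = refl
  length≡∑1 (x ∷ xs) = cong suc (length≡∑1 xs)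

  ∑-distrib-+ : ∀ xs (f g : A → ℕ) → ∑[ x ∈ xs ] (f x + g x) ≡ ∑ xs f + ∑ xs g
  ∑-distrib-+ []       f g = refl
  ∑-distrib-+ (x ∷ xs) f g = trans (cong (f x + g x +_) (∑-distrib-+ xs f g))
                                   (+-+-comm (f x) (g x) (∑ xs f) (∑ xs g))
    where
    +-+-comm : ∀ a b c d → a + b + (c + d) ≡ a + c + (b + d)
    +-+-comm = solve-∀

  *-distribˡ-∑ : ∀ c xs (f : A → ℕ) → c * ∑ xs f ≡ ∑[ x ∈ xs ] (c * f x)
  *-distribˡ-∑ c []       f = *-zeroʳ c
  *-distribˡ-∑ c (x ∷ xs) f =
    trans (*-distribˡ-+ c (f x) (∑ xs f)) (cong (c * f x +_) (*-distribˡ-∑ c xs f))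

  *-distribʳ-∑ : ∀ c xs (f : A → ℕ) → ∑ xs f * c ≡ ∑[ x ∈ xs ] (f x * c)
  *-distribʳ-∑ c xs f = trans (*-comm (∑ xs f) c)
    (trans (*-distribˡ-∑ c xs f) (∑-cong xs (λ {x} _ → *-comm c (f x))))

  ∑-comm : ∀ xs ys (h : A → B → ℕ) →
           ∑[ x ∈ xs ] ∑[ y ∈ ys ] h x y ≡ ∑[ y ∈ ys ] ∑[ x ∈ xs ] h x y
  ∑-comm []       ys h = sym (trans (∑-const ys 0) (*-zeroʳ (length ys)))
  ∑-comm (x ∷ xs) ys h = trans (cong (∑ ys (h x) +_) (∑-comm xs ys h))
                               (sym (∑-distrib-+ ys (h x) (λ y → ∑[ x ∈ xs ] h x y)))

  ∑-++ : ∀ xs ys (f : A → ℕ) → ∑ (xs ++ ys) f ≡ ∑ xs f + ∑ ys f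
  ∑-++ []       ys f = refl
  ∑-++ (x ∷ xs) ys f = trans (cong (f x +_) (∑-++ xs ys f)) (sym (+-assoc (f x) (∑ xs f) (∑ ys f)))

  ∑-map : ∀ (g : A → B) xs f → ∑ (map g xs) f ≡ ∑[ x ∈ xs ] f (g x)
  ∑-map g []       f = refl
  ∑-map g (x ∷ xs) f = cong (f (g x) +_) (∑-map g xs f)

  ∑-cartesianProduct : ∀ xs (ys : List B) (h : A × B → ℕ) →
                       ∑ (cartesianProduct xs ys) h ≡ ∑[ x ∈ xs ] ∑[ y ∈ ys ] h (x , y)
  ∑-cartesianProduct []       ys h = refl
  ∑-cartesianProduct (x ∷ xs) ys h = begin
    ∑ (map (x ,_) ys ++ cartesianProduct xs ys) h          ≡⟨ ∑-++ (map (x ,_) ys) _ h ⟩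
    ∑ (map (x ,_) ys) h + ∑ (cartesianProduct xs ys) h     ≡⟨ cong₂ _+_ (∑-map (x ,_) ys h) (∑-cartesianProduct xs ys h) ⟩
    ∑[ y ∈ ys ] h (x , y) + ∑[ x ∈ xs ] ∑[ y ∈ ys ] h (x , y) ∎
    where open ≡-Reasoning

  length-cartesianProduct : ∀ (xs : List A) (ys : List B) →
                            length (cartesianProduct xs ys) ≡ length xs * length ys
  length-cartesianProduct xs ys = begin
    length (cartesianProduct xs ys)   ≡⟨ length≡∑1 (cartesianProduct xs ys) ⟩
    ∑[ p ∈ cartesianProduct xs ys ] 1 ≡⟨ ∑-cartesianProduct xs ys (λ _ → 1) ⟩
    ∑[ x ∈ xs ] ∑[ y ∈ ys ] 1         ≡⟨ ∑-cong xs (λ _ → sym (length≡∑1 ys)) ⟩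
    ∑[ x ∈ xs ] length ys             ≡⟨ ∑-const xs (length ys) ⟩
    length xs * length ys             ∎
    where open ≡-Reasoning

  ∈⇒≤∑ : ∀ {xs} (f : A → ℕ) {x} → x ∈ xs → f x ≤ ∑ xs f
  ∈⇒≤∑ f (here refl) = m≤m+n _ _
  ∈⇒≤∑ f (there x∈)  = ≤-trans (∈⇒≤∑ f x∈) (m≤n+m _ _)

  2*m*n≤m*m+n*n : ∀ m n → 2 * (m * n) ≤ m * m + n * n
  2*m*n≤m*m+n*n m n = [ ordered , flipped ]′ (≤-total m n)
    where
    square-gap : ∀ a k → a * a + (a + k) * (a + k) ≡ 2 * (a * (a + k)) + k * k
    square-gap = solve-∀
    ordered : ∀ {a b} → a ≤ b → 2 * (a * b) ≤ a * a + b * b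
    ordered {a} a≤b with k , refl ← m≤n⇒∃[o]m+o≡n a≤b =
      subst (2 * (a * (a + k)) ≤_) (sym (square-gap a k)) (m≤m+n _ (k * k))
    flipped : n ≤ m → 2 * (m * n) ≤ m * m + n * n
    flipped n≤m = subst₂ _≤_ (cong (2 *_) (*-comm n m)) (+-comm (n * n) (m * m)) (ordered n≤m)

  cauchy-schwarz : ∀ xs (f : A → ℕ) → ∑ xs f * ∑ xs f ≤ length xs * ∑[ x ∈ xs ] (f x * f x)
  cauchy-schwarz []       f = z≤n
  cauchy-schwarz (x ∷ xs) f = begin
    (a + s) * (a + s)                   ≡⟨ expand a s ⟩
    a * a + 2 * (a * s) + s * s         ≤⟨ +-mono-≤ (+-monoʳ-≤ (a * a) cross) (cauchy-schwarz xs f) ⟩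
    a * a + (n * (a * a) + q) + n * q   ≡⟨ collect a n q ⟩
    suc n * (a * a + q)                 ∎
    where
    open ≤-Reasoning
    a = f x
    s = ∑ xs f
    q = ∑[ y ∈ xs ] (f y * f y)
    n = length xs
    expand : ∀ a s → (a + s) * (a + s) ≡ a * a + 2 * (a * s) + s * s
    expand = solve-∀
    collect : ∀ a n q → a * a + (n * (a * a) + q) + n * q ≡ suc n * (a * a + q)
    collect = solve-∀
    cross : 2 * (a * s) ≤ n * (a * a) + q
    cross = begin
      2 * (a * s)                           ≡⟨ cong (2 *_) (*-distribˡ-∑ a xs f) ⟩
      2 * ∑[ y ∈ xs ] (a * f y)             ≡⟨ *-distribˡ-∑ 2 xs (λ y → a * f y) ⟩
      ∑[ y ∈ xs ] (2 * (a * f y))           ≤⟨ ∑-mono-≤ xs (λ {y} _ → 2*m*n≤m*m+n*n a (f y)) ⟩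
      ∑[ y ∈ xs ] (a * a + f y * f y)       ≡⟨ ∑-distrib-+ xs (λ _ → a * a) (λ y → f y * f y) ⟩
      ∑[ y ∈ xs ] (a * a) + q               ≡⟨ cong (_+ q) (∑-const xs (a * a)) ⟩
      n * (a * a) + q                       ∎

  𝟙 : ∀ {P : Set} → Dec P → ℕ
  𝟙 (yes _) = 1
  𝟙 (no  _) = 0

  𝟙≤1 : ∀ {P : Set} (p? : Dec P) → 𝟙 p? ≤ 1
  𝟙≤1 (yes _) = s≤s z≤n
  𝟙≤1 (no  _) = z≤n

  𝟙-yes : ∀ {P : Set} → P → (p? : Dec P) → 𝟙 p? ≡ 1
  𝟙-yes p (yes _) = refl
  𝟙-yes p (no ¬p) = contradiction p ¬p

  𝟙≤𝟙+𝟙 : ∀ {P Q R : Set} (p? : Dec P) (q? : Dec Q) (r? : Dec R) → (P → Q ⊎ R) → 𝟙 p? ≤ 𝟙 q? + 𝟙 r?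
  𝟙≤𝟙+𝟙 (no  _) q? r? _ = z≤n
  𝟙≤𝟙+𝟙 (yes p) q? r? P⇒Q⊎R with P⇒Q⊎R p
  ... | inj₁ q = subst (_≤ 𝟙 q? + 𝟙 r?) (𝟙-yes q q?) (m≤m+n (𝟙 q?) (𝟙 r?))
  ... | inj₂ r = subst (_≤ 𝟙 q? + 𝟙 r?) (𝟙-yes r r?) (m≤n+m (𝟙 r?) (𝟙 q?))

  ∑-𝟙≡length-filter : ∀ {P : Pred A _} (P? : Decidable P) xs →
                      ∑[ x ∈ xs ] 𝟙 (P? x) ≡ length (filter P? xs)
  ∑-𝟙≡length-filter P? []       = refl
  ∑-𝟙≡length-filter P? (x ∷ xs) with P? x
  ... | yes _ = cong suc (∑-𝟙≡length-filter P? xs)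
  ... | no  _ = ∑-𝟙≡length-filter P? xs

  Unique⇒length≤1 : ∀ {xs : List A} → Unique xs → (∀ {x y} → x ∈ xs → y ∈ xs → x ≡ y) → length xs ≤ 1
  Unique⇒length≤1 {xs = []}         _                 _   = z≤n
  Unique⇒length≤1 {xs = _ ∷ []}     _                 _   = s≤s z≤n
  Unique⇒length≤1 {xs = _ ∷ _ ∷ _} ((x≢y ∷ _) ∷ _) all≡ = contradiction (all≡ (here refl) (there (here refl))) x≢y

  ∑-𝟙≤1 : ∀ {P : Pred A _} (P? : Decidable P) {xs} → Unique xs →
          (∀ {x y} → x ∈ xs → y ∈ xs → P x → P y → x ≡ y) → ∑[ x ∈ xs ] 𝟙 (P? x) ≤ 1
  ∑-𝟙≤1 P? {xs} xs! P-unique = begin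
    ∑[ x ∈ xs ] 𝟙 (P? x)   ≡⟨ ∑-𝟙≡length-filter P? xs ⟩
    length (filter P? xs)  ≤⟨ Unique⇒length≤1 (filter⁺ P? xs!) filtered-unique ⟩
    1                      ∎
    where
    open ≤-Reasoning
    filtered-unique : ∀ {x y} → x ∈ filter P? xs → y ∈ filter P? xs → x ≡ y
    filtered-unique x∈ y∈ with x∈xs , Px ← ∈-filter⁻ P? x∈ | y∈xs , Py ← ∈-filter⁻ P? y∈ =
      P-unique x∈xs y∈xs Px Py

  module _ {B : Set} (_≟_ : DecidableEquality B) where

    length≤∑-fibres : ∀ {xs : List A} {ys : List B} (k : A → B) → (∀ {x} → x ∈ xs → k x ∈ ys) →
                      length xs ≤ ∑[ y ∈ ys ] ∑[ x ∈ xs ] 𝟙 (k x ≟ y)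
    length≤∑-fibres {xs = xs} {ys} k k∈ys = begin
      length xs                               ≡⟨ length≡∑1 xs ⟩
      ∑[ x ∈ xs ] 1                           ≤⟨ ∑-mono-≤ xs (λ x∈ → hit (k∈ys x∈)) ⟩
      ∑[ x ∈ xs ] ∑[ y ∈ ys ] 𝟙 (k x ≟ y)     ≡⟨ ∑-comm xs ys (λ x y → 𝟙 (k x ≟ y)) ⟩
      ∑[ y ∈ ys ] ∑[ x ∈ xs ] 𝟙 (k x ≟ y)     ∎
      where
      open ≤-Reasoning
      hit : ∀ {x} → k x ∈ ys → 1 ≤ ∑[ y ∈ ys ] 𝟙 (k x ≟ y)
      hit {x} kx∈ys = subst (_≤ ∑[ y ∈ ys ] 𝟙 (k x ≟ y)) (𝟙-yes refl (k x ≟ k x))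
                            (∈⇒≤∑ (λ y → 𝟙 (k x ≟ y)) kx∈ys)

    length≤length-of-injection : ∀ {xs : List A} {ys : List B} (k : A → B) → Unique xs →
      (∀ {x} → x ∈ xs → k x ∈ ys) → (∀ {x x'} → x ∈ xs → x' ∈ xs → k x ≡ k x' → x ≡ x') →
      length xs ≤ length ys
    length≤length-of-injection {xs = xs} {ys} k xs! k∈ys k-injective = begin
      length xs                               ≤⟨ length≤∑-fibres k k∈ys ⟩
      ∑[ y ∈ ys ] ∑[ x ∈ xs ] 𝟙 (k x ≟ y)     ≤⟨ ∑-mono-≤ ys (λ {y} _ → fibre≤1 y) ⟩
      ∑[ y ∈ ys ] 1                           ≡⟨ length≡∑1 ys ⟨
      length ys                               ∎
      where
      open ≤-Reasoning
      fibre≤1 : ∀ y → ∑[ x ∈ xs ] 𝟙 (k x ≟ y) ≤ 1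
      fibre≤1 y = ∑-𝟙≤1 (λ x → k x ≟ y) xs! (λ x∈ x'∈ kx≡y kx'≡y → k-injective x∈ x'∈ (trans kx≡y (sym kx'≡y)))

    ∑-𝟙≟*𝟙≟≤𝟙≟ : ∀ {ys} → Unique ys → ∀ a b → ∑[ y ∈ ys ] (𝟙 (a ≟ y) * 𝟙 (b ≟ y)) ≤ 𝟙 (a ≟ b)
    ∑-𝟙≟*𝟙≟≤𝟙≟ {ys} ys! a b with a ≟ b
    ... | yes refl = begin
      ∑[ y ∈ ys ] (𝟙 (a ≟ y) * 𝟙 (a ≟ y))  ≤⟨ ∑-mono-≤ ys (λ {y} _ → *-monoʳ-≤ (𝟙 (a ≟ y)) (𝟙≤1 (a ≟ y))) ⟩
      ∑[ y ∈ ys ] (𝟙 (a ≟ y) * 1)          ≡⟨ ∑-cong ys (λ {y} _ → *-identityʳ (𝟙 (a ≟ y))) ⟩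
      ∑[ y ∈ ys ] 𝟙 (a ≟ y)                ≤⟨ ∑-𝟙≤1 (a ≟_) ys! (λ _ _ a≡y a≡y' → trans (sym a≡y) a≡y') ⟩
      1                                    ∎
      where open ≤-Reasoning
    ... | no a≢b = ≤-reflexive (begin
      ∑[ y ∈ ys ] (𝟙 (a ≟ y) * 𝟙 (b ≟ y))  ≡⟨ ∑-cong ys (λ {y} _ → disjoint y) ⟩
      ∑[ y ∈ ys ] 0                        ≡⟨ ∑-const ys 0 ⟩
      length ys * 0                        ≡⟨ *-zeroʳ (length ys) ⟩
      0                                    ∎)
      where
      open ≡-Reasoning
      disjoint : ∀ y → 𝟙 (a ≟ y) * 𝟙 (b ≟ y) ≡ 0
      disjoint y with a ≟ y | b ≟ y
      ... | yes a≡y | yes b≡y = contradiction (trans a≡y (sym b≡y)) a≢b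
      ... | yes _   | no  _   = refl
      ... | no  _   | _       = refl

module Rectangles where

  open Counting
  open import Data.Nat.Base using (ℕ; _+_; _*_; _^_; _≤_)
  open import Data.Nat.Properties using (*-identityʳ; +-mono-≤; +-monoˡ-≤; *-mono-≤; *-monoʳ-≤; module ≤-Reasoning)
  open import Data.Nat.Tactic.RingSolver using (solve-∀)
  open import Data.List.Base using (List; length; filter; cartesianProduct)
  open import Data.List.Membership.Propositional using (_∈_)
  open import Data.List.Membership.Propositional.Properties
    using (∈-filter⁻; ∈-cartesianProduct⁺; ∈-cartesianProduct⁻)
  open import Data.List.Relation.Binary.Subset.Propositional using (_⊆_)
  open import Data.List.Relation.Unary.Unique.Propositional using (Unique)
  open import Data.List.Relation.Unary.Unique.Propositional.Properties using (filter⁺; cartesianProduct⁺)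
  open import Data.Product.Base using (_×_; _,_; proj₁; proj₂; uncurry)
  open import Data.Product.Properties using (≡-dec)
  open import Data.Sum.Base using (_⊎_; inj₁; inj₂)
  open import Function.Base using (_∘_; id)
  open import Relation.Binary.Definitions using (DecidableEquality)
  open import Relation.Binary.PropositionalEquality
  open import Relation.Nullary using (Dec; yes; no; ¬?)
  open import Relation.Nullary.Decidable using (_×-dec_)

  RectangleFree : {P Q : Set} → List (P × Q) → Set
  RectangleFree S = ∀ {x x' y y'} → (x , y) ∈ S → (x , y') ∈ S → (x' , y) ∈ S → (x' , y') ∈ S → y ≢ y' → x ≡ x'

  module _ {P Q : Set} (_≟₁_ : DecidableEquality P) (_≟₂_ : DecidableEquality Q) where

    private
      _≟_ : DecidableEquality (P × Q)
      _≟_ = ≡-dec _≟₁_ _≟₂_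

    degree : List (P × Q) → P → ℕ
    degree S x = ∑[ s ∈ S ] 𝟙 (proj₁ s ≟₁ x)

    collisions : List (P × Q) → ℕ
    collisions S = ∑[ s ∈ S ] ∑[ t ∈ S ] 𝟙 (proj₁ s ≟₁ proj₁ t)

    splitPair? : ∀ (s t : P × Q) → Dec (proj₁ s ≡ proj₁ t × proj₂ s ≢ proj₂ t)
    splitPair? s t = (proj₁ s ≟₁ proj₁ t) ×-dec ¬? (proj₂ s ≟₂ proj₂ t)

    module _ {E₁ : List P} {E₂ : List Q} {S : List (P × Q)} (S⊆E₁×E₂ : S ⊆ cartesianProduct E₁ E₂) where

      length≤∑-degree : length S ≤ ∑[ x ∈ E₁ ] degree S x
      length≤∑-degree = length≤∑-fibres _≟₁_ proj₁ (proj₁ ∘ ∈-cartesianProduct⁻ E₁ E₂ ∘ S⊆E₁×E₂)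

      ∑-degree²≤collisions : Unique E₁ → ∑[ x ∈ E₁ ] (degree S x * degree S x) ≤ collisions S
      ∑-degree²≤collisions E₁! = begin
        ∑[ x ∈ E₁ ] (degree S x * degree S x)          ≡⟨ ∑-cong E₁ (λ {x} _ → expand x) ⟩
        ∑[ x ∈ E₁ ] ∑[ s ∈ S ] ∑[ t ∈ S ] both s t x   ≡⟨ ∑-comm E₁ S _ ⟩
        ∑[ s ∈ S ] ∑[ x ∈ E₁ ] ∑[ t ∈ S ] both s t x   ≡⟨ ∑-cong S (λ _ → ∑-comm E₁ S _) ⟩
        ∑[ s ∈ S ] ∑[ t ∈ S ] ∑[ x ∈ E₁ ] both s t x   ≤⟨ ∑-mono-≤ S (λ {s} _ → ∑-mono-≤ S (λ {t} _ →
                                                            ∑-𝟙≟*𝟙≟≤𝟙≟ _≟₁_ E₁! (proj₁ s) (proj₁ t))) ⟩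
        collisions S                                   ∎
        where
        open ≤-Reasoning
        both : P × Q → P × Q → P → ℕ
        both s t x = 𝟙 (proj₁ s ≟₁ x) * 𝟙 (proj₁ t ≟₁ x)
        expand : ∀ x → degree S x * degree S x ≡ ∑[ s ∈ S ] ∑[ t ∈ S ] both s t x
        expand x = trans (*-distribʳ-∑ (degree S x) S _)
                         (∑-cong S (λ {s} _ → *-distribˡ-∑ (𝟙 (proj₁ s ≟₁ x)) S _))

      splitPairs≤ : Unique S → RectangleFree S →
                    ∑[ s ∈ S ] ∑[ t ∈ S ] 𝟙 (splitPair? s t) ≤ length E₂ * length E₂
      splitPairs≤ S! S-rectangleFree = begin
        ∑[ s ∈ S ] ∑[ t ∈ S ] 𝟙 (splitPair? s t)          ≡⟨ ∑-cartesianProduct S S (𝟙 ∘ uncurry splitPair?) ⟨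
        ∑[ p ∈ cartesianProduct S S ] 𝟙 (splitPair?′ p)   ≡⟨ ∑-𝟙≡length-filter splitPair?′ (cartesianProduct S S) ⟩
        length splitPairs                                 ≤⟨ length≤length-of-injection (≡-dec _≟₂_ _≟₂_) seconds
                                                               (filter⁺ splitPair?′ (cartesianProduct⁺ S! S!))
                                                               seconds∈ seconds-injective ⟩
        length (cartesianProduct E₂ E₂)                   ≡⟨ length-cartesianProduct E₂ E₂ ⟩
        length E₂ * length E₂                             ∎
        where
        open ≤-Reasoning
        splitPair?′ = uncurry splitPair?
        splitPairs = filter splitPair?′ (cartesianProduct S S)
        seconds : (P × Q) × (P × Q) → Q × Q
        seconds (s , t) = proj₂ s , proj₂ t
        ∈E₂ : ∀ {s} → s ∈ S → proj₂ s ∈ E₂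
        ∈E₂ = proj₂ ∘ ∈-cartesianProduct⁻ E₁ E₂ ∘ S⊆E₁×E₂
        seconds∈ : ∀ {p} → p ∈ splitPairs → seconds p ∈ cartesianProduct E₂ E₂
        seconds∈ p∈ with s∈ , t∈ ← ∈-cartesianProduct⁻ S S (proj₁ (∈-filter⁻ splitPair?′ p∈)) =
          ∈-cartesianProduct⁺ (∈E₂ s∈) (∈E₂ t∈)
        -- p = ((x , y) , (x , y')) with y ≢ y'; rectangle-freeness recovers x from (y , y').
        seconds-injective : ∀ {p p'} → p ∈ splitPairs → p' ∈ splitPairs → seconds p ≡ seconds p' → p ≡ p'
        seconds-injective p∈ p'∈ refl
          with st∈ , refl , y≢y' ← ∈-filter⁻ splitPair?′ p∈ | s't'∈ , refl , _ ← ∈-filter⁻ splitPair?′ p'∈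
          with s∈ , t∈ ← ∈-cartesianProduct⁻ S S st∈ | s'∈ , t'∈ ← ∈-cartesianProduct⁻ S S s't'∈
          rewrite S-rectangleFree s∈ t∈ s'∈ t'∈ y≢y' = refl

      collisions≤ : Unique S → RectangleFree S → collisions S ≤ length S + length E₂ * length E₂
      collisions≤ S! S-rectangleFree = begin
        collisions S
          ≤⟨ ∑-mono-≤ S (λ {s} _ → ∑-mono-≤ S (λ {t} _ → split s t)) ⟩
        ∑[ s ∈ S ] ∑[ t ∈ S ] (𝟙 (s ≟ t) + 𝟙 (splitPair? s t))
          ≡⟨ ∑-cong S (λ {s} _ → ∑-distrib-+ S (λ t → 𝟙 (s ≟ t)) _) ⟩
        ∑[ s ∈ S ] (∑[ t ∈ S ] 𝟙 (s ≟ t) + ∑[ t ∈ S ] 𝟙 (splitPair? s t))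
          ≡⟨ ∑-distrib-+ S _ _ ⟩
        ∑[ s ∈ S ] ∑[ t ∈ S ] 𝟙 (s ≟ t) + ∑[ s ∈ S ] ∑[ t ∈ S ] 𝟙 (splitPair? s t)
          ≤⟨ +-mono-≤ diagonal (splitPairs≤ S! S-rectangleFree) ⟩
        length S + length E₂ * length E₂
          ∎
        where
        open ≤-Reasoning
        split : ∀ s t → 𝟙 (proj₁ s ≟₁ proj₁ t) ≤ 𝟙 (s ≟ t) + 𝟙 (splitPair? s t)
        split s t = 𝟙≤𝟙+𝟙 (proj₁ s ≟₁ proj₁ t) (s ≟ t) (splitPair? s t) equal-or-split
          where
          equal-or-split : proj₁ s ≡ proj₁ t → s ≡ t ⊎ (proj₁ s ≡ proj₁ t × proj₂ s ≢ proj₂ t)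
          equal-or-split s₁≡t₁ with proj₂ s ≟₂ proj₂ t
          ... | yes s₂≡t₂ = inj₁ (cong₂ _,_ s₁≡t₁ s₂≡t₂)
          ... | no  s₂≢t₂ = inj₂ (s₁≡t₁ , s₂≢t₂)
        diagonal : ∑[ s ∈ S ] ∑[ t ∈ S ] 𝟙 (s ≟ t) ≤ length S
        diagonal = begin
          ∑[ s ∈ S ] ∑[ t ∈ S ] 𝟙 (s ≟ t)  ≤⟨ ∑-mono-≤ S (λ {s} _ → ∑-𝟙≤1 (s ≟_) S! (λ _ _ s≡t s≡t' → trans (sym s≡t) s≡t')) ⟩
          ∑[ s ∈ S ] 1                     ≡⟨ length≡∑1 S ⟨
          length S                         ∎

      rectangleFree-length² : Unique E₁ → Unique S → RectangleFree S →
                              length S * length S ≤ length E₁ * (length S + length E₂ * length E₂)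
      rectangleFree-length² E₁! S! S-rectangleFree = begin
        length S * length S                                 ≤⟨ *-mono-≤ length≤∑-degree length≤∑-degree ⟩
        ∑[ x ∈ E₁ ] degree S x * ∑[ x ∈ E₁ ] degree S x     ≤⟨ cauchy-schwarz E₁ (degree S) ⟩
        length E₁ * ∑[ x ∈ E₁ ] (degree S x * degree S x)   ≤⟨ *-monoʳ-≤ (length E₁) (∑-degree²≤collisions E₁!) ⟩
        length E₁ * collisions S                            ≤⟨ *-monoʳ-≤ (length E₁) (collisions≤ S! S-rectangleFree) ⟩
        length E₁ * (length S + length E₂ * length E₂)      ∎
        where open ≤-Reasoning

  module _ {P : Set} (_≟_ : DecidableEquality P) where

    rectangleFree-bound : ∀ {E : List P} {S : List (P × P)} → Unique E → Unique S →
                          S ⊆ cartesianProduct E E → RectangleFree S → length S ^ 2 ≤ 2 * length E ^ 3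
    rectangleFree-bound {E} {S} E! S! S⊆E×E S-rectangleFree = begin
      m ^ 2                   ≡⟨ cong (m *_) (*-identityʳ m) ⟩
      m * m                   ≤⟨ rectangleFree-length² _≟_ _≟_ S⊆E×E E! S! S-rectangleFree ⟩
      n * (m + n * n)         ≤⟨ *-monoʳ-≤ n (+-monoˡ-≤ (n * n) m≤n*n) ⟩
      n * (n * n + n * n)     ≡⟨ twice-cube n ⟩
      2 * n ^ 3               ∎
      where
      open ≤-Reasoning
      m = length S
      n = length E
      -- n ^ 3 written out, since the reflective solver does not recognise ℕ's _^_
      twice-cube : ∀ n → n * (n * n + n * n) ≡ 2 * (n * (n * (n * 1)))
      twice-cube = solve-∀
      m≤n*n : m ≤ n * n
      m≤n*n = begin
        m                              ≤⟨ length≤length-of-injection (≡-dec _≟_ _≟_) id S! S⊆E×E (λ _ _ → id) ⟩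
        length (cartesianProduct E E)  ≡⟨ length-cartesianProduct E E ⟩
        n * n                          ∎

module PlaneGeometry (F : FiniteField) where

  open import Level using (0ℓ)
  open import Data.Empty using (⊥-elim)
  import Data.Fin.Properties as Fin
  open import Data.Integer.Base using (+_)
  open import Data.List.Base using (List; map; cartesianProduct)
  open import Data.List.Membership.Propositional using (_∈_)
  open import Data.List.Membership.Propositional.Properties using (∈-map⁻; ∈-cartesianProduct⁺)
  open import Data.List.Relation.Binary.Subset.Propositional using (_⊆_)
  open import Data.List.Relation.Unary.All as All using (All)
  open import Data.List.Relation.Unary.Unique.Propositional using (Unique)
  open import Data.List.Relation.Unary.Unique.Propositional.Properties using (map⁺)
  open import Data.Product.Base using (_×_; _,_; proj₁; proj₂; swap)
  open import Data.Product.Properties using (≡-dec)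
  open import Function.Base using (_∘_)
  open import Function.Properties.Inverse using (↔-sym; ↔⇒↣)
  open import Relation.Binary.Definitions using (DecidableEquality)
  open import Relation.Binary.PropositionalEquality
  open import Relation.Nullary using (Dec; yes; no)
  open import Relation.Nullary.Decidable using (via-injection)
  open Rectangles using (RectangleFree)

  open FiniteField F

  commutativeRing : CommutativeRing 0ℓ 0ℓ
  commutativeRing = record { isCommutativeRing = isCommutativeRing }

  open CommutativeRing commutativeRing using (*-comm; *-identityˡ; *-identityʳ)
  open import Algebra.Properties.Ring (CommutativeRing.ring commutativeRing) using (x∙y⁻¹≈ε⇒x≈y)
  open IntegerRingSolver commutativeRing using (solve; _:=_; _:+_; _:*_; _:-_; :-_; con)
  open ≡-Reasoning

  _≟_ : DecidableEquality Carrier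
  _≟_ = via-injection (↔⇒↣ (↔-sym enum)) Fin._≟_

  *-cancelˡ : ∀ {c x y} → c ≢ 0# → c * x ≡ c * y → x ≡ y
  *-cancelˡ {c} {x} {y} c≢0 cx≡cy = begin
    x              ≡⟨ undo x ⟨
    c⁻¹ * (c * x)  ≡⟨ cong (c⁻¹ *_) cx≡cy ⟩
    c⁻¹ * (c * y)  ≡⟨ undo y ⟩
    y              ∎
    where
    c⁻¹ = proj₁ (inverse c c≢0)
    undo : ∀ z → c⁻¹ * (c * z) ≡ z
    undo z = begin
      c⁻¹ * (c * z)  ≡⟨ solve 3 (λ c d z → d :* (c :* z) := (c :* d) :* z) refl c c⁻¹ z ⟩
      (c * c⁻¹) * z  ≡⟨ cong (_* z) (proj₂ (inverse c c≢0)) ⟩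
      1# * z         ≡⟨ *-identityˡ z ⟩
      z              ∎

  infixr 7 _•_
  infix  7 _·_

  _•_ : Carrier → Point → Point
  t • (x₁ , x₂) = (t * x₁ , t * x₂)

  _·_ : Point → Point → Carrier
  (r₁ , r₂) · (x₁ , x₂) = r₁ * x₁ + r₂ * x₂

  det₂ : Point → Point → Carrier
  det₂ (x₁ , x₂) (y₁ , y₂) = det (mat x₁ y₁ x₂ y₂)

  perp : Point → Point
  perp (y₁ , y₂) = (y₂ , - y₁)

  •-identityˡ : ∀ p → 1# • p ≡ p
  •-identityˡ (p₁ , p₂) = cong₂ _,_ (*-identityˡ p₁) (*-identityˡ p₂)

  •-cancelˡ : ∀ {c p q} → c ≢ 0# → c • p ≡ c • q → p ≡ q
  •-cancelˡ c≢0 eq = cong₂ _,_ (*-cancelˡ c≢0 (cong proj₁ eq)) (*-cancelˡ c≢0 (cong proj₂ eq))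

  det₂-act : ∀ θ x y → det₂ (act θ x) (act θ y) ≡ det θ * det₂ x y
  det₂-act (mat a b c d) (x₁ , x₂) (y₁ , y₂) = solve 8
    (λ a b c d x₁ x₂ y₁ y₂ →
       (a :* x₁ :+ b :* x₂) :* (c :* y₁ :+ d :* y₂) :- (a :* y₁ :+ b :* y₂) :* (c :* x₁ :+ d :* x₂)
       := (a :* d :- b :* c) :* (x₁ :* y₂ :- y₁ :* x₂))
    refl a b c d x₁ x₂ y₁ y₂

  det₂-originʳ : ∀ x → det₂ x origin ≡ 0#
  det₂-originʳ (x₁ , x₂) =
    solve 2 (λ x₁ x₂ → x₁ :* con (+ 0) :- con (+ 0) :* x₂ := con (+ 0)) refl x₁ x₂

  det₂-•ʳ : ∀ t x y → det₂ x (t • y) ≡ det₂ x y * t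
  det₂-•ʳ t (x₁ , x₂) (y₁ , y₂) = solve 5
    (λ t x₁ x₂ y₁ y₂ → x₁ :* (t :* y₂) :- (t :* y₁) :* x₂ := (x₁ :* y₂ :- y₁ :* x₂) :* t)
    refl t x₁ x₂ y₁ y₂

  det₂≡·perp : ∀ x y → det₂ x y ≡ x · perp y
  det₂≡·perp (x₁ , x₂) (y₁ , y₂) = solve 4
    (λ x₁ x₂ y₁ y₂ → x₁ :* y₂ :- y₁ :* x₂ := x₁ :* y₂ :+ x₂ :* (:- y₁))
    refl x₁ x₂ y₁ y₂

  det₂-perp : ∀ y z → det₂ (perp y) (perp z) ≡ det₂ y z
  det₂-perp (y₁ , y₂) (z₁ , z₂) = solve 4
    (λ y₁ y₂ z₁ z₂ → y₂ :* (:- z₁) :- z₂ :* (:- y₁) := y₁ :* z₂ :- z₁ :* y₂)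
    refl y₁ y₂ z₁ z₂

  cramer : Point → Point → Carrier → Carrier → Point
  cramer (u₁ , u₂) (v₁ , v₂) α β = (α * v₂ - β * u₂ , β * u₁ - α * v₁)

  det₂•≡cramer : ∀ u v r → det₂ u v • r ≡ cramer u v (r · u) (r · v)
  det₂•≡cramer (u₁ , u₂) (v₁ , v₂) (r₁ , r₂) = cong₂ _,_
    (solve 6 (λ u₁ u₂ v₁ v₂ r₁ r₂ →
       (u₁ :* v₂ :- v₁ :* u₂) :* r₁
       := (r₁ :* u₁ :+ r₂ :* u₂) :* v₂ :- (r₁ :* v₁ :+ r₂ :* v₂) :* u₂)
     refl u₁ u₂ v₁ v₂ r₁ r₂)
    (solve 6 (λ u₁ u₂ v₁ v₂ r₁ r₂ →
       (u₁ :* v₂ :- v₁ :* u₂) :* r₂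
       := (r₁ :* v₁ :+ r₂ :* v₂) :* u₁ :- (r₁ :* u₁ :+ r₂ :* u₂) :* v₁)
     refl u₁ u₂ v₁ v₂ r₁ r₂)

  ·-determined : ∀ {u v r s} → det₂ u v ≢ 0# → r · u ≡ s · u → r · v ≡ s · v → r ≡ s
  ·-determined {u} {v} {r} {s} uv≢0 ru≡su rv≡sv = •-cancelˡ uv≢0 (begin
    det₂ u v • r                ≡⟨ det₂•≡cramer u v r ⟩
    cramer u v (r · u) (r · v)  ≡⟨ cong₂ (cramer u v) ru≡su rv≡sv ⟩
    cramer u v (s · u) (s · v)  ≡⟨ det₂•≡cramer u v s ⟨
    det₂ u v • s                ∎)

  fromRows : Point → Point → Mat
  fromRows (a , b) (c , d) = mat a b c d

  act-determined : ∀ {u v} θ φ → det₂ u v ≢ 0# → act θ u ≡ act φ u → act θ v ≡ act φ v → θ ≡ φ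
  act-determined (mat a b c d) (mat a' b' c' d') uv≢0 θu≡φu θv≡φv = cong₂ fromRows
    (·-determined uv≢0 (cong proj₁ θu≡φu) (cong proj₁ θv≡φv))
    (·-determined uv≢0 (cong proj₂ θu≡φu) (cong proj₂ θv≡φv))

  proportional⇒OnLine : ∀ {w₁ w₂ p₁ p₂} → w₁ ≢ 0# → w₁ * p₂ ≡ p₁ * w₂ → OnLine (w₁ , w₂) (p₁ , p₂)
  proportional⇒OnLine {w₁} {w₂} {p₁} {p₂} w₁≢0 cross =
    p₁ * w₁⁻¹ , cong₂ _,_ (sym (p₁-along)) (*-cancelˡ w₁≢0 p₂-along)
    where
    w₁⁻¹ = proj₁ (inverse w₁ w₁≢0)
    w₁w₁⁻¹≡1 : w₁ * w₁⁻¹ ≡ 1#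
    w₁w₁⁻¹≡1 = proj₂ (inverse w₁ w₁≢0)
    p₁-along : p₁ * w₁⁻¹ * w₁ ≡ p₁
    p₁-along = begin
      p₁ * w₁⁻¹ * w₁    ≡⟨ solve 3 (λ p w i → p :* i :* w := p :* (w :* i)) refl p₁ w₁ w₁⁻¹ ⟩
      p₁ * (w₁ * w₁⁻¹)  ≡⟨ cong (p₁ *_) w₁w₁⁻¹≡1 ⟩
      p₁ * 1#           ≡⟨ *-identityʳ p₁ ⟩
      p₁                ∎
    p₂-along : w₁ * p₂ ≡ w₁ * (p₁ * w₁⁻¹ * w₂)
    p₂-along = begin
      w₁ * p₂                 ≡⟨ cross ⟩
      p₁ * w₂                 ≡⟨ *-identityˡ (p₁ * w₂) ⟨
      1# * (p₁ * w₂)          ≡⟨ cong (_* (p₁ * w₂)) w₁w₁⁻¹≡1 ⟨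
      w₁ * w₁⁻¹ * (p₁ * w₂)   ≡⟨ solve 4 (λ w i p v → w :* i :* (p :* v) := w :* (p :* i :* v)) refl w₁ w₁⁻¹ p₁ w₂ ⟩
      w₁ * (p₁ * w₁⁻¹ * w₂)   ∎

  det₂≡0⇒OnLine : ∀ {w p} → w ≢ origin → det₂ w p ≡ 0# → OnLine w p
  det₂≡0⇒OnLine {w₁ , w₂} {p₁ , p₂} w≢0 wp≡0 = by-cases (w₁ ≟ 0#)
    where
    cross : w₁ * p₂ ≡ p₁ * w₂
    cross = x∙y⁻¹≈ε⇒x≈y _ _ wp≡0
    by-cases : Dec (w₁ ≡ 0#) → OnLine (w₁ , w₂) (p₁ , p₂)
    by-cases (no w₁≢0)  = proportional⇒OnLine w₁≢0 cross
    by-cases (yes w₁≡0) = let t , p≡tw = proportional⇒OnLine w₂≢0 cross′ in t , cong swap p≡tw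
      where
      w₂≢0 : w₂ ≢ 0#
      w₂≢0 w₂≡0 = w≢0 (cong₂ _,_ w₁≡0 w₂≡0)
      cross′ : w₂ * p₁ ≡ p₂ * w₁
      cross′ = trans (*-comm w₂ p₁) (trans (sym cross) (*-comm w₁ p₂))

  -- If det₂ y z ≢ 0#, the point x is a linear form fixed by its value D on the basis perp y, perp z.
  -- Otherwise z = t • y, and det₂ x z = t * D forces t ≡ 1#, i.e. z ≡ y.
  det₂-rectangle : ∀ {D x x' y z} → D ≢ 0# →
                   det₂ x y ≡ D → det₂ x z ≡ D → det₂ x' y ≡ D → det₂ x' z ≡ D → y ≢ z → x ≡ x'
  det₂-rectangle {D} {x} {x'} {y} {z} D≢0 xy xz x'y x'z y≢z with det₂ y z ≟ 0#
  ... | no yz≢0 = ·-determined (yz≢0 ∘ trans (sym (det₂-perp y z))) (agree xy x'y) (agree xz x'z)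
    where
    agree : ∀ {w} → det₂ x w ≡ D → det₂ x' w ≡ D → x · perp w ≡ x' · perp w
    agree {w} xw x'w = begin
      x · perp w   ≡⟨ det₂≡·perp x w ⟨
      det₂ x w     ≡⟨ trans xw (sym x'w) ⟩
      det₂ x' w    ≡⟨ det₂≡·perp x' w ⟩
      x' · perp w  ∎
  ... | yes yz≡0 = ⊥-elim (y≢z (sym z≡y))
    where
    y≢0 : y ≢ origin
    y≢0 y≡0 = D≢0 (trans (sym xy) (trans (cong (det₂ x) y≡0) (det₂-originʳ x)))
    z-on-y : OnLine y z
    z-on-y = det₂≡0⇒OnLine y≢0 yz≡0
    t = proj₁ z-on-y
    t≡1 : t ≡ 1#
    t≡1 = *-cancelˡ D≢0 (begin
      D * t              ≡⟨ cong (_* t) xy ⟨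
      det₂ x y * t       ≡⟨ det₂-•ʳ t x y ⟨
      det₂ x (t • y)     ≡⟨ cong (det₂ x) (proj₂ z-on-y) ⟨
      det₂ x z           ≡⟨ xz ⟩
      D                  ≡⟨ *-identityʳ D ⟨
      D * 1#             ∎)
    z≡y : z ≡ y
    z≡y = trans (proj₂ z-on-y) (trans (cong (_• y) t≡1) (•-identityˡ y))

  _≟ᴾ_ : DecidableEquality Point
  _≟ᴾ_ = ≡-dec _≟_ _≟_

  orbitPairs : Point → Point → List Mat → List (Point × Point)
  orbitPairs u v = map (λ θ → act θ u , act θ v)

  orbitPairs-unique : ∀ {u v R} → det₂ u v ≢ 0# → Unique R → Unique (orbitPairs u v R)
  orbitPairs-unique uv≢0 = map⁺ (λ {θ} {φ} θ≡φ → act-determined θ φ uv≢0 (cong proj₁ θ≡φ) (cong proj₂ θ≡φ))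

  orbitPairs⊆ : ∀ {u v R E} → u ∈ E → v ∈ E → All (λ θ → Preserves θ E) R →
                orbitPairs u v R ⊆ cartesianProduct E E
  orbitPairs⊆ u∈E v∈E R-preserves s∈ with θ , θ∈R , refl ← ∈-map⁻ _ s∈ =
    ∈-cartesianProduct⁺ (θ[E]⊆E _ u∈E) (θ[E]⊆E _ v∈E)
    where θ[E]⊆E = proj₁ (All.lookup R-preserves θ∈R)

  orbitPairs-det₂ : ∀ {u v R x y} → All InSL2 R → (x , y) ∈ orbitPairs u v R → det₂ x y ≡ det₂ u v
  orbitPairs-det₂ {u} {v} R⊆SL₂ xy∈ with θ , θ∈R , refl ← ∈-map⁻ _ xy∈ = begin
    det₂ (act θ u) (act θ v)  ≡⟨ det₂-act θ u v ⟩
    det θ * det₂ u v          ≡⟨ cong (_* det₂ u v) (All.lookup R⊆SL₂ θ∈R) ⟩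
    1# * det₂ u v             ≡⟨ *-identityˡ (det₂ u v) ⟩
    det₂ u v                  ∎

  orbitPairs-rectangleFree : ∀ {u v R} → det₂ u v ≢ 0# → All InSL2 R → RectangleFree (orbitPairs u v R)
  orbitPairs-rectangleFree {u} {v} {R} uv≢0 R⊆SL₂ xy∈ xy'∈ x'y∈ x'y'∈ =
    det₂-rectangle uv≢0 (on-level xy∈) (on-level xy'∈) (on-level x'y∈) (on-level x'y'∈)
    where
    on-level : ∀ {x y} → (x , y) ∈ orbitPairs u v R → det₂ x y ≡ det₂ u v
    on-level = orbitPairs-det₂ R⊆SL₂

module SL₂Stabiliser (F : FiniteField) where

  open import Data.Nat.Base using (_*_; _^_; _≤_)
  open import Data.Nat.Properties using (module ≤-Reasoning)
  open import Data.List.Base using (List; length)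
  open import Data.List.Properties using (length-map)
  open import Data.List.Relation.Unary.All using (All; unzip)
  open import Data.List.Relation.Unary.Unique.Propositional using (Unique)
  open import Data.Product.Base using (_×_; _,_; proj₁; proj₂)
  open import Relation.Binary.PropositionalEquality using (_≢_; cong)
  open FiniteField F using (0#; Point; Mat; InSL2; Preserves; TwoLines)
  open PlaneGeometry F
    using (_≟ᴾ_; det₂; det₂≡0⇒OnLine; orbitPairs; orbitPairs-unique; orbitPairs⊆; orbitPairs-rectangleFree)
  open Rectangles using (rectangleFree-bound)
  open ≤-Reasoning

  stabiliser-bound : ∀ {E : List Point} {R : List Mat} → Unique E → TwoLines E → Unique R →
                     All (λ θ → InSL2 θ × Preserves θ E) R → length R ^ 2 ≤ 2 * length E ^ 3
  stabiliser-bound {E} {R} E! (u , v , u∈E , v∈E , u≢0 , _ , u∦v) R! R-SL₂-preserving = begin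
    length R ^ 2                    ≡⟨ cong (_^ 2) (length-map _ R) ⟨
    length (orbitPairs u v R) ^ 2   ≤⟨ rectangleFree-bound _≟ᴾ_ E!
                                         (orbitPairs-unique uv≢0 R!)
                                         (orbitPairs⊆ u∈E v∈E R-preserves)
                                         (orbitPairs-rectangleFree uv≢0 R⊆SL₂) ⟩
    2 * length E ^ 3                ∎
    where
    uv≢0 : det₂ u v ≢ 0#
    uv≢0 uv≡0 = u∦v (det₂≡0⇒OnLine u≢0 uv≡0)
    R⊆SL₂ = proj₁ (unzip R-SL₂-preserving)
    R-preserves = proj₂ (unzip R-SL₂-preserving)

open import Data.Nat using (ℕ; _*_; _^_; _≤_)
open import Data.Product using (∃; _×_)
open import Data.List using (List; length)
open import Data.List.Relation.Unary.All using (All)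
open import Data.List.Relation.Unary.Unique.Propositional using (Unique)
open import Data.Product using (_,_)

theorem1p8 : ∃ λ (C : ℕ) → (F : FiniteField) →
    (E : List (FiniteField.Point F)) → Unique E → FiniteField.TwoLines F E →
    (R : List (FiniteField.Mat F)) → Unique R →
    All (λ θ → FiniteField.InSL2 F θ × FiniteField.Preserves F θ E) R →
    length R ^ 2 ≤ C * length E ^ 3
theorem1p8 = 2 , λ F E E! two-lines R R! R-SL₂-preserving →
  SL₂Stabiliser.stabiliser-bound F E! two-lines R! R-SL₂-preserving
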